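{- Let $n\geq 2$. The $2$-dicoloring graph $\mathcal{D}_2(\vec{C}_{2n+1}\langle\emptyset\rangle)$ of the cyclic circulant tournament is (isomorphic to) the cycle $C_{4n+2}$. Moreover, $\operatorname{diam}(\mathcal{D}_2(\vec{C}_{2n+1}\langle\emptyset\rangle))=2n+1$.
   Context: For $n\ge 2$, the cyclic circulant tournament $\vec{C}_{2n+1}\langle\emptyset\rangle=\vec{C}_{2n+1}(1,2,\dots,n)$ has vertex set $\mathbb{Z}_{2n+1}$ and arcs $(a,a+j)$ for all $a\in\mathbb{Z}_{2n+1}$ and $j\in\{1,\dots,n\}$. For a digraph $D$ and positive integer $k$, a $k$-coloring of $D$ is a function $\alpha\colon V(D)\to\{1,\dots,k\}$ such that every color class $\{x:\alpha(x)=i\}$ (possibly empty) induces an acyclic subdigraph. The $k$-dicoloring graph $\mathcal{D}_k(D)$ has the $k$-colorings of $D$ as vertices, two being adjacent iff they differ on exactly one vertex. -}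

module Defs where

open import Data.Nat using (ℕ; zero; suc; _+_; _*_; _≤_; _<_; NonZero)
open import Data.Nat.DivMod using (_%_)
open import Data.Fin using (Fin; toℕ; inject₁; fromℕ) renaming (zero to fzero; suc to fsuc)
open import Data.Vec using (Vec; lookup)
open import Data.Sum using (_⊎_)
open import Data.Product using (Σ; ∃; ∃-syntax; _×_; _,_; proj₁)
open import Relation.Binary.PropositionalEquality using (_≡_)
open import Relation.Nullary using (¬_)

Digraph : ℕ → Set₁
Digraph m = Fin m → Fin m → Set

record DirectedCycleIn {m : ℕ} (D : Digraph m) (S : Fin m → Set) : Set where
  field
    k      : ℕ
    k≥1    : 1 ≤ k
    c      : Fin (suc k) → Fin m
    inS    : ∀ i → S (c i)
    distinct : ∀ i j → c i ≡ c j → i ≡ j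
    step   : ∀ (i : Fin k) → D (c (inject₁ i)) (c (fsuc i))
    close  : D (c (fromℕ k)) (c fzero)

InducesAcyclic : {m : ℕ} → Digraph m → (Fin m → Set) → Set
InducesAcyclic D S = ¬ DirectedCycleIn D S

IsDicoloring : {m : ℕ} (k : ℕ) → Digraph m → Vec (Fin k) m → Set
IsDicoloring k D α = ∀ (i : Fin k) → InducesAcyclic D (λ x → lookup α x ≡ i)

Dicoloring : {m : ℕ} (k : ℕ) → Digraph m → Set
Dicoloring {m} k D = Σ (Vec (Fin k) m) (IsDicoloring k D)

DifferOnExactlyOne : {m k : ℕ} → Vec (Fin k) m → Vec (Fin k) m → Set
DifferOnExactlyOne {m} α β =
  Σ (Fin m) λ v → (¬ lookup α v ≡ lookup β v) × (∀ w → ¬ w ≡ v → lookup α w ≡ lookup β w)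

DicolAdj : {m k : ℕ} {D : Digraph m} → Dicoloring k D → Dicoloring k D → Set
DicolAdj α β = DifferOnExactlyOne (proj₁ α) (proj₁ β)

CyclicTournament : (n : ℕ) → Digraph (suc (2 * n))
CyclicTournament n a b =
  Σ ℕ λ j → (1 ≤ j) × (j ≤ n) × (toℕ b ≡ (toℕ a + j) % suc (2 * n))

CycleAdj : (N : ℕ) → .{{_ : NonZero N}} → Fin N → Fin N → Set
CycleAdj N i j = (toℕ j ≡ (toℕ i + 1) % N) ⊎ (toℕ i ≡ (toℕ j + 1) % N)

-- Graph isomorphism from C_N onto D_k(D).  Vertices of D_k(D) are
-- identified when their underlying colourings are equal (the
-- acyclicity proof component carries no information).

record CycleIsoDicolGraph (N : ℕ) .{{_ : NonZero N}} {m : ℕ} (k : ℕ) (D : Digraph m) : Set where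
  field
    f        : Fin N → Dicoloring k D
    injective  : ∀ i j → proj₁ (f i) ≡ proj₁ (f j) → i ≡ j
    surjective : ∀ (α : Dicoloring k D) → Σ (Fin N) λ i → proj₁ (f i) ≡ proj₁ α
    adj⇔     : ∀ i j → (CycleAdj N i j → DicolAdj (f i) (f j)) × (DicolAdj (f i) (f j) → CycleAdj N i j)

data Walk {V : Set} (Adj : V → V → Set) : V → V → ℕ → Set where
  here : ∀ {x} → Walk Adj x x 0
  step : ∀ {x y z l} → Adj x y → Walk Adj y z l → Walk Adj x z (suc l)

Dist : {V : Set} (Adj : V → V → Set) → V → V → ℕ → Set
Dist Adj x y d = Walk Adj x y d × (∀ l → l < d → ¬ Walk Adj x y l)

Diameter : {V : Set} (Adj : V → V → Set) → ℕ → Set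
Diameter {V} Adj d =
  (∀ x y → Σ ℕ λ e → (e ≤ d) × Dist Adj x y e) × (Σ V λ x → Σ V λ y → Dist Adj x y d)

{-# OPTIONS --safe #-}
module Submission where

-- The block colouring χ(x , c) of ℤ_{2n+1} gives x+1, …, x+n the colour c̄ ≠ c and the
-- other n+1 vertices the colour c.  Any set inside an interval {b, …, b+n} is acyclic,
-- because offsets from b increase along its arcs, so every χ(x , c) is a 2-dicolouring.
-- Conversely, let α be a 2-dicolouring.  Some x has the colour of x+n+1: otherwise α would
-- be constant along steps of 2(n+1) ≡ 1.  Forbidding the monochromatic directed triangles
-- x, x+p, x+n+1 (1 ≤ p ≤ n) and x+1, x+1+t, x+n+1+t (1 ≤ t < n) then forces α = χ(x , α x).
-- The same two triangles show that recolouring one vertex of χ(x , c) yields a dicolouring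
-- only at x+n+1, giving χ(x+n+1 , c̄), and at x, giving χ(x+n , c̄).  So the 2-dicolouring
-- graph is the functional graph of (x , c) ↦ (x+n+1 , c̄), whose square is (x , c) ↦ (x+1 , c):
-- a single cycle of length 2(2n+1), hence of diameter 2n+1.

open import Defs
open import Data.Empty using (⊥; ⊥-elim)
open import Data.Fin using (Fin; toℕ; _≟_; inject₁; fromℕ; fromℕ<; opposite) renaming (zero to fzero; suc to fsuc)
open import Data.Fin.Patterns using (0F; 1F; 2F)
open import Data.Fin.Properties using (toℕ-injective; toℕ-fromℕ<; toℕ<n; any?; opposite-involutive)
open import Data.Nat using (ℕ; zero; suc; _+_; _*_; _∸_; _≤_; _<_; _⊓_; z≤n; s≤s; NonZero; _<?_)
open import Data.Nat.DivMod using (_%_; _mod_; m%n<n; m<n⇒m%n≡m; [m+n]%n≡m%n; %-distribˡ-+; m%n%n≡m%n; n%n≡0)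
open import Data.Nat.GeneralisedArithmetic using (fold)
open import Data.Nat.Properties
  using ( +-identityʳ; +-assoc; +-comm; +-suc; +-mono-≤; +-mono-<; +-mono-≤-<; +-monoˡ-<; +-monoʳ-<
        ; +-cancelˡ-<; suc-injective; m+[n∸m]≡n; m∸n+n≡m; m+n∸n≡m; m+n∸m≡n; ∸-monoʳ-≤
        ; ≤-refl; ≤-reflexive; ≤-trans; ≤-total; <-irrefl; <-trans; <-≤-trans; ≤-<-trans
        ; <⇒≤; <⇒≢; <⇒≱; ≮⇒≥; ≰⇒>; n≤1+n; m≤m+n; m≤n+m; m<m+n; m<n+m; m≤n⇒m≤1+n
        ; m≤n⇒m<n∨m≡n; m≤n⇒∃[o]m+o≡n; m<n⇒0<n; m<n⇒0<n∸m; m⊓n≤m; m⊓n≤n; ⊓-sel; ⊓-idem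
        ; module ≤-Reasoning )
open import Data.Nat.Tactic.RingSolver using (solve-∀)
open import Data.Product using (Σ; ∃-syntax; _×_; _,_; proj₁; proj₂)
open import Data.Sum using (_⊎_; inj₁; inj₂)
import Data.Sum as Sum
open import Data.Vec using (Vec; lookup; tabulate)
open import Data.Vec.Properties using (lookup∘tabulate)
open import Data.Vec.Relation.Binary.Pointwise.Extensional using (ext; Pointwise-≡⇒≡)
open import Function.Base using (_∘_)
open import Function.Bundles using (_⇔_; mk⇔; Equivalence)
open import Relation.Binary.PropositionalEquality
  using (_≡_; _≢_; refl; sym; trans; cong; cong₂; subst; subst₂; module ≡-Reasoning)
open import Relation.Nullary using (¬_; yes; no)

open Equivalence using (to; from)

opposite-≢ : ∀ (c : Fin 2) → opposite c ≢ c
opposite-≢ 0F ()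
opposite-≢ 1F ()

≢⇒≡opposite : ∀ {a c : Fin 2} → a ≢ c → a ≡ opposite c
≢⇒≡opposite {0F} {0F} a≢c = ⊥-elim (a≢c refl)
≢⇒≡opposite {0F} {1F} _   = refl
≢⇒≡opposite {1F} {0F} _   = refl
≢⇒≡opposite {1F} {1F} a≢c = ⊥-elim (a≢c refl)

≢opposite⇒≡ : ∀ {a c : Fin 2} → a ≢ opposite c → a ≡ c
≢opposite⇒≡ {c = c} a≢c̄ = trans (≢⇒≡opposite a≢c̄) (opposite-involutive c)

DiffersExactlyAt : ∀ {m k} → Fin m → Vec (Fin k) m → Vec (Fin k) m → Set
DiffersExactlyAt v α β = (lookup α v ≢ lookup β v) × (∀ w → w ≢ v → lookup α w ≡ lookup β w)

DiffersExactlyAt-sym : ∀ {m k v} {α β : Vec (Fin k) m} → DiffersExactlyAt v α β → DiffersExactlyAt v β α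
DiffersExactlyAt-sym (α≢β , α≡β) = α≢β ∘ sym , λ w w≢v → sym (α≡β w w≢v)

DiffersExactlyAt-unique : ∀ {m v} {α β γ : Vec (Fin 2) m} →
                          DiffersExactlyAt v α β → DiffersExactlyAt v α γ → β ≡ γ
DiffersExactlyAt-unique {v = v} {α} {β} {γ} (α≢β , α≡β) (α≢γ , α≡γ) = Pointwise-≡⇒≡ (ext β≗γ)
  where
  β≗γ : ∀ w → lookup β w ≡ lookup γ w
  β≗γ w with w ≟ v
  ... | yes refl = trans (≢⇒≡opposite (α≢β ∘ sym)) (sym (≢⇒≡opposite (α≢γ ∘ sym)))
  ... | no  w≢v  = trans (sym (α≡β w w≢v)) (α≡γ w w≢v)

increasing⇒head≤last : ∀ k (h : Fin (suc k) → ℕ) → (∀ (i : Fin k) → h (inject₁ i) < h (fsuc i)) →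
                       h fzero ≤ h (fromℕ k)
increasing⇒head≤last zero    h inc = ≤-refl
increasing⇒head≤last (suc k) h inc =
  ≤-trans (increasing⇒head≤last k (h ∘ inject₁) (inc ∘ inject₁)) (<⇒≤ (inc (fromℕ k)))

mapWalk : ∀ {V W : Set} {A : V → V → Set} {B : W → W → Set} (h : V → W) →
          (∀ {x y} → A x y → B (h x) (h y)) → ∀ {x y l} → Walk A x y l → Walk B (h x) (h y) l
mapWalk h h-hom here       = here
mapWalk h h-hom (step a w) = step (h-hom a) (mapWalk h h-hom w)

module _ {V W : Set} {A : V → V → Set} {B : W → W → Set}
         (f : V → W) (g : W → V) (g∘f : ∀ x → g (f x) ≡ x) (f∘g : ∀ y → f (g y) ≡ y)
         (f-hom : ∀ {x x′} → A x x′ → B (f x) (f x′))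
         (g-hom : ∀ {y y′} → B y y′ → A (g y) (g y′)) where

  Dist-map : ∀ {x x′ d} → Dist A x x′ d → Dist B (f x) (f x′) d
  Dist-map {x} {x′} {d} (walk , minimal) = mapWalk f f-hom walk , no-shorter
    where
    no-shorter : ∀ l → l < d → ¬ Walk B (f x) (f x′) l
    no-shorter l l<d walk′ =
      minimal l l<d (subst₂ (λ u v → Walk A u v l) (g∘f x) (g∘f x′) (mapWalk g g-hom walk′))

  Diameter-map : ∀ {d} → Diameter A d → Diameter B d
  Diameter-map {d} (bounded , x , x′ , far) = bounded′ , f x , f x′ , Dist-map far
    where
    bounded′ : ∀ y y′ → Σ ℕ λ e → (e ≤ d) × Dist B y y′ e
    bounded′ y y′ with bounded (g y) (g y′)
    ... | e , e≤d , dist = e , e≤d , subst₂ (λ u v → Dist B u v e) (f∘g y) (f∘g y′) (Dist-map dist)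

-- The acyclicity proofs are functions into ⊥, which is definitionally proof-irrelevant.
Dicoloring-≡ : ∀ {m k} {D : Digraph m} {α β : Dicoloring k D} → proj₁ α ≡ proj₁ β → α ≡ β
Dicoloring-≡ refl = refl

CycleIso⇒Diameter : ∀ {N} .{{_ : NonZero N}} {m k} {D : Digraph m} {d} → CycleIsoDicolGraph N k D →
                    Diameter (CycleAdj N) d → Diameter (DicolAdj {k = k} {D = D}) d
CycleIso⇒Diameter {N} {k = k} {D} iso = Diameter-map f g g∘f f∘g (λ {i} {j} → proj₁ (adj⇔ i j)) g-hom
  where
  open CycleIsoDicolGraph iso
  g : Dicoloring k D → Fin N
  g α = proj₁ (surjective α)
  f∘g : ∀ α → f (g α) ≡ α
  f∘g α = Dicoloring-≡ (proj₂ (surjective α))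
  g∘f : ∀ i → g (f i) ≡ i
  g∘f i = injective _ _ (proj₂ (surjective (f i)))
  g-hom : ∀ {α β} → DicolAdj α β → CycleAdj N (g α) (g β)
  g-hom {α} {β} adj = proj₂ (adj⇔ (g α) (g β)) (subst₂ DicolAdj (sym (f∘g α)) (sym (f∘g β)) adj)

module Cyclic (M : ℕ) .{{_ : NonZero M}} where

  infixl 6 _⊕_

  _⊕_ : Fin M → ℕ → Fin M
  x ⊕ s = (toℕ x + s) mod M

  toℕ-⊕ : ∀ x s → toℕ (x ⊕ s) ≡ (toℕ x + s) % M
  toℕ-⊕ x s = toℕ-fromℕ< (m%n<n (toℕ x + s) M)

  toℕ-⊕1 : ∀ x → toℕ (x ⊕ 1) ≡ suc (toℕ x) % M
  toℕ-⊕1 x = trans (toℕ-⊕ x 1) (cong (_% M) (+-comm (toℕ x) 1))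

  private
    [m%M+n]%M≡[m+n]%M : ∀ m n → (m % M + n) % M ≡ (m + n) % M
    [m%M+n]%M≡[m+n]%M m n = begin
      (m % M + n) % M            ≡⟨ %-distribˡ-+ (m % M) n M ⟩
      (m % M % M + n % M) % M    ≡⟨ cong (λ k → (k + n % M) % M) (m%n%n≡m%n m M) ⟩
      (m % M + n % M) % M        ≡⟨ %-distribˡ-+ m n M ⟨
      (m + n) % M                ∎
      where open ≡-Reasoning

  ⊕-assoc : ∀ x s t → x ⊕ s ⊕ t ≡ x ⊕ (s + t)
  ⊕-assoc x s t = toℕ-injective (begin
    toℕ (x ⊕ s ⊕ t)            ≡⟨ toℕ-⊕ (x ⊕ s) t ⟩
    (toℕ (x ⊕ s) + t) % M      ≡⟨ cong (λ k → (k + t) % M) (toℕ-⊕ x s) ⟩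
    ((toℕ x + s) % M + t) % M  ≡⟨ [m%M+n]%M≡[m+n]%M (toℕ x + s) t ⟩
    (toℕ x + s + t) % M        ≡⟨ cong (_% M) (+-assoc (toℕ x) s t) ⟩
    (toℕ x + (s + t)) % M      ≡⟨ toℕ-⊕ x (s + t) ⟨
    toℕ (x ⊕ (s + t))          ∎)
    where open ≡-Reasoning

  ⊕-swap : ∀ x s t → x ⊕ s ⊕ t ≡ x ⊕ t ⊕ s
  ⊕-swap x s t = trans (⊕-assoc x s t) (trans (cong (x ⊕_) (+-comm s t)) (sym (⊕-assoc x t s)))

  ⊕-suc : ∀ x s → x ⊕ suc s ≡ x ⊕ s ⊕ 1
  ⊕-suc x s = sym (trans (⊕-assoc x s 1) (cong (x ⊕_) (+-comm s 1)))

  ⊕-identityʳ : ∀ x → x ⊕ 0 ≡ x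
  ⊕-identityʳ x = toℕ-injective (begin
    toℕ (x ⊕ 0)         ≡⟨ toℕ-⊕ x 0 ⟩
    (toℕ x + 0) % M     ≡⟨ cong (_% M) (+-identityʳ (toℕ x)) ⟩
    toℕ x % M           ≡⟨ m<n⇒m%n≡m (toℕ<n x) ⟩
    toℕ x               ∎)
    where open ≡-Reasoning

  ⊕-period : ∀ x s → x ⊕ (M + s) ≡ x ⊕ s
  ⊕-period x s = toℕ-injective (begin
    toℕ (x ⊕ (M + s))           ≡⟨ toℕ-⊕ x (M + s) ⟩
    (toℕ x + (M + s)) % M       ≡⟨ cong (_% M) (+-assoc (toℕ x) M s) ⟨
    (toℕ x + M + s) % M         ≡⟨ [m%M+n]%M≡[m+n]%M (toℕ x + M) s ⟨
    ((toℕ x + M) % M + s) % M   ≡⟨ cong (λ k → (k + s) % M) ([m+n]%n≡m%n (toℕ x) M) ⟩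
    (toℕ x % M + s) % M         ≡⟨ [m%M+n]%M≡[m+n]%M (toℕ x) s ⟩
    (toℕ x + s) % M             ≡⟨ toℕ-⊕ x s ⟨
    toℕ (x ⊕ s)                 ∎)
    where open ≡-Reasoning

  ⊕-M : ∀ x → x ⊕ M ≡ x
  ⊕-M x = trans (cong (x ⊕_) (sym (+-identityʳ M))) (trans (⊕-period x 0) (⊕-identityʳ x))

  offset : Fin M → Fin M → ℕ
  offset x y = (toℕ y + (M ∸ toℕ x)) % M

  offset<M : ∀ x y → offset x y < M
  offset<M x y = m%n<n (toℕ y + (M ∸ toℕ x)) M

  offset-⊕ : ∀ x s → offset x (x ⊕ s) ≡ s % M
  offset-⊕ x s = begin
    (toℕ (x ⊕ s) + (M ∸ toℕ x)) % M      ≡⟨ cong (λ k → (k + (M ∸ toℕ x)) % M) (toℕ-⊕ x s) ⟩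
    ((toℕ x + s) % M + (M ∸ toℕ x)) % M  ≡⟨ [m%M+n]%M≡[m+n]%M (toℕ x + s) (M ∸ toℕ x) ⟩
    (toℕ x + s + (M ∸ toℕ x)) % M        ≡⟨ cong (_% M) (+-assoc (toℕ x) s (M ∸ toℕ x)) ⟩
    (toℕ x + (s + (M ∸ toℕ x))) % M      ≡⟨ cong (_% M) (+-comm (toℕ x) (s + (M ∸ toℕ x))) ⟩
    (s + (M ∸ toℕ x) + toℕ x) % M        ≡⟨ cong (_% M) (+-assoc s (M ∸ toℕ x) (toℕ x)) ⟩
    (s + ((M ∸ toℕ x) + toℕ x)) % M      ≡⟨ cong (λ k → (s + k) % M) (m∸n+n≡m (<⇒≤ (toℕ<n x))) ⟩
    (s + M) % M                          ≡⟨ [m+n]%n≡m%n s M ⟩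
    s % M                                ∎
    where open ≡-Reasoning

  ⊕-offset : ∀ x y → x ⊕ offset x y ≡ y
  ⊕-offset x y = toℕ-injective (begin
    toℕ (x ⊕ offset x y)                ≡⟨ toℕ-⊕ x (offset x y) ⟩
    (toℕ x + (y′ + x̄) % M) % M          ≡⟨ cong (_% M) (+-comm (toℕ x) _) ⟩
    ((y′ + x̄) % M + toℕ x) % M          ≡⟨ [m%M+n]%M≡[m+n]%M (y′ + x̄) (toℕ x) ⟩
    (y′ + x̄ + toℕ x) % M                ≡⟨ cong (_% M) (+-assoc y′ x̄ (toℕ x)) ⟩
    (y′ + (x̄ + toℕ x)) % M              ≡⟨ cong (λ k → (y′ + k) % M) (m∸n+n≡m (<⇒≤ (toℕ<n x))) ⟩
    (y′ + M) % M                        ≡⟨ [m+n]%n≡m%n y′ M ⟩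
    y′ % M                              ≡⟨ m<n⇒m%n≡m (toℕ<n y) ⟩
    y′                                  ∎)
    where
    open ≡-Reasoning
    y′ x̄ : ℕ
    y′ = toℕ y
    x̄ = M ∸ toℕ x

  by-offset : ∀ x {P : Fin M → Set} → (∀ s → s < M → P (x ⊕ s)) → ∀ w → P w
  by-offset x {P} P⊕ w = subst P (⊕-offset x w) (P⊕ (offset x w) (offset<M x w))

  offset-⊕< : ∀ x {s} → s < M → offset x (x ⊕ s) ≡ s
  offset-⊕< x {s} s<M = trans (offset-⊕ x s) (m<n⇒m%n≡m s<M)

  offset-self : ∀ x → offset x x ≡ 0
  offset-self x = trans (cong (offset x) (sym (⊕-identityʳ x))) (offset-⊕< x (m<n⇒0<n (toℕ<n x)))

  offset-⊕ʳ : ∀ z x s → offset z (x ⊕ s) ≡ (offset z x + s) % M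
  offset-⊕ʳ z x s = begin
    offset z (x ⊕ s)                 ≡⟨ cong (λ y → offset z (y ⊕ s)) (⊕-offset z x) ⟨
    offset z (z ⊕ offset z x ⊕ s)    ≡⟨ cong (offset z) (⊕-assoc z (offset z x) s) ⟩
    offset z (z ⊕ (offset z x + s))  ≡⟨ offset-⊕ z (offset z x + s) ⟩
    (offset z x + s) % M             ∎
    where open ≡-Reasoning

  ⊕-injective : ∀ x {s t} → s < M → t < M → x ⊕ s ≡ x ⊕ t → s ≡ t
  ⊕-injective x {s} {t} s<M t<M eq =
    trans (sym (offset-⊕< x s<M)) (trans (cong (offset x) eq) (offset-⊕< x t<M))

  suc-%-cases : ∀ {p} → p < M → (suc p % M ≡ suc p) ⊎ (suc p ≡ M × suc p % M ≡ 0)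
  suc-%-cases {p} p<M with m≤n⇒m<n∨m≡n p<M
  ... | inj₁ 1+p<M = inj₁ (m<n⇒m%n≡m 1+p<M)
  ... | inj₂ 1+p≡M = inj₂ (1+p≡M , trans (cong (_% M) 1+p≡M) (n%n≡0 M))

  cycleAdj⇔ : ∀ x y → CycleAdj M x y ⇔ (y ≡ x ⊕ 1 ⊎ x ≡ y ⊕ 1)
  cycleAdj⇔ x y = mk⇔ adj⇒ adj⇐
    where
    adj⇒ : CycleAdj M x y → y ≡ x ⊕ 1 ⊎ x ≡ y ⊕ 1
    adj⇒ (inj₁ eq) = inj₁ (toℕ-injective (trans eq (sym (toℕ-⊕ x 1))))
    adj⇒ (inj₂ eq) = inj₂ (toℕ-injective (trans eq (sym (toℕ-⊕ y 1))))
    adj⇐ : y ≡ x ⊕ 1 ⊎ x ≡ y ⊕ 1 → CycleAdj M x y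
    adj⇐ (inj₁ refl) = inj₁ (toℕ-⊕ x 1)
    adj⇐ (inj₂ refl) = inj₂ (toℕ-⊕ y 1)

  module _ {V : Set} (next : V → V) (v₀ : V) (period : fold v₀ next M ≡ v₀)
           (injective : ∀ {i j} → i < M → j < M → fold v₀ next i ≡ fold v₀ next j → i ≡ j) where

    private
      orbit : Fin M → V
      orbit i = fold v₀ next (toℕ i)

      orbit-⊕1 : ∀ i → orbit (i ⊕ 1) ≡ next (orbit i)
      orbit-⊕1 i with suc-%-cases (toℕ<n i)
      ... | inj₁ eq           = cong (fold v₀ next) (trans (toℕ-⊕1 i) eq)
      ... | inj₂ (1+i≡M , eq) = begin
        orbit (i ⊕ 1)        ≡⟨ cong (fold v₀ next) (trans (toℕ-⊕1 i) eq) ⟩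
        v₀                   ≡⟨ period ⟨
        fold v₀ next M       ≡⟨ cong (fold v₀ next) 1+i≡M ⟨
        next (orbit i)       ∎
        where open ≡-Reasoning

      ≡⊕1⇔ : ∀ i j → (j ≡ i ⊕ 1) ⇔ (orbit j ≡ next (orbit i))
      ≡⊕1⇔ i j = mk⇔ (λ { refl → orbit-⊕1 i })
        (λ eq → toℕ-injective (injective (toℕ<n j) (toℕ<n (i ⊕ 1)) (trans eq (sym (orbit-⊕1 i)))))

    cycleAdj⇔orbitAdj : ∀ i j → CycleAdj M i j ⇔ (fold v₀ next (toℕ j) ≡ next (fold v₀ next (toℕ i))
                                                  ⊎ fold v₀ next (toℕ i) ≡ next (fold v₀ next (toℕ j)))
    cycleAdj⇔orbitAdj i j = mk⇔
      (Sum.map (to (≡⊕1⇔ i j)) (to (≡⊕1⇔ j i)) ∘ to (cycleAdj⇔ i j))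
      (from (cycleAdj⇔ i j) ∘ Sum.map (from (≡⊕1⇔ i j)) (from (≡⊕1⇔ j i)))

  walk-down : ∀ z p → Walk (CycleAdj M) (z ⊕ p) z p
  walk-down z zero    = subst (λ y → Walk (CycleAdj M) y z 0) (sym (⊕-identityʳ z)) here
  walk-down z (suc p) = step (from (cycleAdj⇔ _ _) (inj₂ (⊕-suc z p))) (walk-down z p)

  walk-up : ∀ z p t → p + t ≡ M → Walk (CycleAdj M) (z ⊕ p) z t
  walk-up z p zero    p+0≡M = subst (λ y → Walk (CycleAdj M) y z 0) z≡z⊕p here
    where
    z≡z⊕p : z ≡ z ⊕ p
    z≡z⊕p = sym (trans (cong (z ⊕_) (trans (sym (+-identityʳ p)) p+0≡M)) (⊕-M z))
  walk-up z p (suc t) p+1+t≡M =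
    step (from (cycleAdj⇔ _ _) (inj₁ (⊕-suc z p))) (walk-up z (suc p) t (trans (sym (+-suc p t)) p+1+t≡M))

  private
    -- Spans p l holds iff l ≥ min p (M ∸ p), the distance in the cycle C_M of two vertices at offset p.
    Spans : ℕ → ℕ → Set
    Spans p l = p ≤ l ⊎ M ≤ p + l

    spans-suc : ∀ {p l} → p < M → Spans p l → Spans (suc p % M) (suc l)
    spans-suc {p} {l} p<M spans with suc-%-cases p<M
    ... | inj₁ eq       = subst (λ q → Spans q (suc l)) (sym eq)
                            (Sum.map s≤s (λ M≤p+l → ≤-trans M≤p+l (+-mono-≤ (n≤1+n p) (n≤1+n l))) spans)
    ... | inj₂ (_ , eq) = subst (λ q → Spans q (suc l)) (sym eq) (inj₁ z≤n)

    spans-pred : ∀ {p l} → p < M → Spans (suc p % M) l → Spans p (suc l)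
    spans-pred {p} {l} p<M spans with suc-%-cases p<M
    ... | inj₁ eq          = Sum.map (λ p<l → m≤n⇒m≤1+n (<⇒≤ p<l))
                                     (λ M≤1+p+l → ≤-trans M≤1+p+l (≤-reflexive (sym (+-suc p l))))
                                     (subst (λ q → Spans q l) eq spans)
    ... | inj₂ (1+p≡M , _) = inj₂ (begin
      M            ≡⟨ 1+p≡M ⟨
      suc p        ≤⟨ s≤s (m≤m+n p l) ⟩
      suc (p + l)  ≡⟨ +-suc p l ⟨
      p + suc l    ∎)
      where open ≤-Reasoning

    offset-⊕1 : ∀ z x → offset z (x ⊕ 1) ≡ suc (offset z x) % M
    offset-⊕1 z x = trans (offset-⊕ʳ z x 1) (cong (_% M) (+-comm (offset z x) 1))

    walk-spans : ∀ {x z l} → Walk (CycleAdj M) x z l → Spans (offset z x) l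
    walk-spans {x} here = inj₁ (≤-reflexive (offset-self x))
    walk-spans {x} {z} (step {y = y} adj w) with to (cycleAdj⇔ x y) adj
    ... | inj₁ refl = spans-pred (offset<M z x) (subst (λ q → Spans q _) (offset-⊕1 z x) (walk-spans w))
    ... | inj₂ refl = subst (λ q → Spans q _) (sym (offset-⊕1 z y)) (spans-suc (offset<M z y) (walk-spans w))

  cycle-dist : ∀ x z → Dist (CycleAdj M) x z (offset z x ⊓ (M ∸ offset z x))
  cycle-dist x z = shortest , no-shorter
    where
    p : ℕ
    p = offset z x
    shortest : Walk (CycleAdj M) x z (p ⊓ (M ∸ p))
    shortest with ⊓-sel p (M ∸ p)
    ... | inj₁ eq = subst₂ (λ y l → Walk (CycleAdj M) y z l) (⊕-offset z x) (sym eq) (walk-down z p)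
    ... | inj₂ eq = subst₂ (λ y l → Walk (CycleAdj M) y z l) (⊕-offset z x) (sym eq)
                      (walk-up z p (M ∸ p) (m+[n∸m]≡n (<⇒≤ (offset<M z x))))
    no-shorter : ∀ l → l < p ⊓ (M ∸ p) → ¬ Walk (CycleAdj M) x z l
    no-shorter l l<dist w with walk-spans w
    ... | inj₁ p≤l   = <⇒≱ (<-≤-trans l<dist (m⊓n≤m p (M ∸ p))) p≤l
    ... | inj₂ M≤p+l = <⇒≱ (begin-strict
      p + l        <⟨ +-monoʳ-< p (<-≤-trans l<dist (m⊓n≤n p (M ∸ p))) ⟩
      p + (M ∸ p)  ≡⟨ m+[n∸m]≡n (<⇒≤ (offset<M z x)) ⟩
      M            ∎) M≤p+l
      where open ≤-Reasoning

  cycle-diameter : ∀ {T} → 0 < T → M ≡ T + T → Diameter (CycleAdj M) T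
  cycle-diameter {T} 0<T M≡T+T = (λ x z → _ , dist≤T x z , cycle-dist x z) , o ⊕ T , o , far
    where
    M∸T≡T : M ∸ T ≡ T
    M∸T≡T = trans (cong (_∸ T) M≡T+T) (m+n∸n≡m T T)
    dist≤T : ∀ x z → offset z x ⊓ (M ∸ offset z x) ≤ T
    dist≤T x z with ≤-total (offset z x) T
    ... | inj₁ p≤T = ≤-trans (m⊓n≤m _ _) p≤T
    ... | inj₂ T≤p = ≤-trans (m⊓n≤n _ _) (≤-trans (∸-monoʳ-≤ M T≤p) (≤-reflexive M∸T≡T))
    o : Fin M
    o = 0 mod M
    T<M : T < M
    T<M = subst (T <_) (sym M≡T+T) (m<m+n T 0<T)
    far : Dist (CycleAdj M) (o ⊕ T) o T
    far = subst (Dist (CycleAdj M) (o ⊕ T) o) dist≡T (cycle-dist (o ⊕ T) o)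
      where
      dist≡T : offset o (o ⊕ T) ⊓ (M ∸ offset o (o ⊕ T)) ≡ T
      dist≡T = trans (cong (λ p → p ⊓ (M ∸ p)) (offset-⊕< o T<M))
                     (trans (cong (T ⊓_) M∸T≡T) (⊓-idem T))

private
  n+1+n≡N : ∀ n → n + suc n ≡ suc (2 * n)
  n+1+n≡N = solve-∀
  1+n+1+n≡N+1 : ∀ n → suc n + suc n ≡ suc (2 * n) + 1
  1+n+1+n≡N+1 = solve-∀
  1+n+[n+s]≡N+s : ∀ n s → suc n + (n + s) ≡ suc (2 * n) + s
  1+n+[n+s]≡N+s = solve-∀
  1+n+t+1+n≡N+1+t : ∀ n t → suc n + t + suc n ≡ suc (2 * n) + suc t
  1+n+t+1+n≡N+1+t = solve-∀
  K≡N+N : ∀ n → suc (4 * n + 1) ≡ suc (2 * n) + suc (2 * n)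
  K≡N+N = solve-∀
  K≡T+T : ∀ n → suc (4 * n + 1) ≡ (2 * n + 1) + (2 * n + 1)
  K≡T+T = solve-∀

module Tournament (n : ℕ) where

  N : ℕ
  N = suc (2 * n)

  open Cyclic N public

  D : Digraph N
  D = CyclicTournament n

  N≡1+n+n : N ≡ suc (n + n)
  N≡1+n+n = cong suc (cong (n +_) (+-identityʳ n))

  n<N : n < N
  n<N = s≤s (m≤m+n n (n + 0))

  +-bounded : ∀ {a b} → a ≤ n → b ≤ n → a + b < N
  +-bounded {a} {b} a≤n b≤n = subst (a + b <_) (sym N≡1+n+n) (s≤s (+-mono-≤ a≤n b≤n))

  ⊕0≡⊕1+n⊕n : ∀ x → x ⊕ 0 ≡ x ⊕ suc n ⊕ n
  ⊕0≡⊕1+n⊕n x = begin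
    x ⊕ 0              ≡⟨ ⊕-identityʳ x ⟩
    x                  ≡⟨ ⊕-M x ⟨
    x ⊕ N              ≡⟨ cong (x ⊕_) N≡1+n+n ⟩
    x ⊕ (suc n + n)    ≡⟨ ⊕-assoc x (suc n) n ⟨
    x ⊕ suc n ⊕ n      ∎
    where open ≡-Reasoning

  ⊕n⊕1+n : ∀ x → x ⊕ n ⊕ suc n ≡ x
  ⊕n⊕1+n x = trans (⊕-assoc x n (suc n)) (trans (cong (x ⊕_) (n+1+n≡N n)) (⊕-M x))

  ⊕1+n⊕1+n : ∀ x → x ⊕ suc n ⊕ suc n ≡ x ⊕ 1
  ⊕1+n⊕1+n x = trans (⊕-assoc x (suc n) (suc n)) (trans (cong (x ⊕_) (1+n+1+n≡N+1 n)) (⊕-period x 1))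

  ⊕1+n-injective : ∀ {x y} → x ⊕ suc n ≡ y ⊕ suc n → x ≡ y
  ⊕1+n-injective {x} {y} eq = begin
    x                  ≡⟨ ⊕n⊕1+n x ⟨
    x ⊕ n ⊕ suc n      ≡⟨ ⊕-swap x n (suc n) ⟩
    x ⊕ suc n ⊕ n      ≡⟨ cong (_⊕ n) eq ⟩
    y ⊕ suc n ⊕ n      ≡⟨ ⊕-swap y (suc n) n ⟩
    y ⊕ n ⊕ suc n      ≡⟨ ⊕n⊕1+n y ⟩
    y                  ∎
    where open ≡-Reasoning

  arc : ∀ x {j} → 1 ≤ j → j ≤ n → D x (x ⊕ j)
  arc x {j} 1≤j j≤n = j , 1≤j , j≤n , toℕ-⊕ x j

  offset-increasing : ∀ b x {y} → offset b x ≤ n → D x y → offset b x < offset b y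
  offset-increasing b x {y} bx≤n (j , 1≤j , j≤n , y≡x+j) = begin-strict
    offset b x            <⟨ m<m+n (offset b x) 1≤j ⟩
    offset b x + j        ≡⟨ m<n⇒m%n≡m (+-bounded bx≤n j≤n) ⟨
    (offset b x + j) % N  ≡⟨ offset-⊕ʳ b x j ⟨
    offset b (x ⊕ j)      ≡⟨ cong (offset b) (toℕ-injective (trans y≡x+j (sym (toℕ-⊕ x j)))) ⟨
    offset b y            ∎
    where open ≤-Reasoning

  acyclic-within : ∀ b {S : Fin N → Set} → (∀ w → S w → offset b w ≤ n) → InducesAcyclic D S
  acyclic-within b {S} near cycle =
    <-irrefl refl (<-≤-trans (offset-increasing b (c (fromℕ k)) (near _ (inS (fromℕ k))) close)
                             (increasing⇒head≤last k rank rank-increasing))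
    where
    open DirectedCycleIn cycle using (k; c; inS; close) renaming (step to arcs)
    rank : Fin (suc k) → ℕ
    rank i = offset b (c i)
    rank-increasing : ∀ i → rank (inject₁ i) < rank (fsuc i)
    rank-increasing i = offset-increasing b (c (inject₁ i)) (near _ (inS (inject₁ i))) (arcs i)

  triangle : ∀ y {a b} {S : Fin N → Set} → 1 ≤ a → a ≤ n → 1 ≤ b → b ≤ n → n < a + b →
             S y → S (y ⊕ a) → S (y ⊕ (a + b)) → DirectedCycleIn D S
  triangle y {a} {b} {S} 1≤a a≤n 1≤b b≤n n<a+b Sy Sya Syab = record
    { k = 2 ; k≥1 = s≤s z≤n ; c = vertex ; inS = inS ; distinct = distinct ; step = arcs ; close = closing }
    where
    position : Fin 3 → ℕ
    position 0F = 0
    position 1F = a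
    position 2F = a + b
    vertex : Fin 3 → Fin N
    vertex i = y ⊕ position i
    inS : ∀ i → S (vertex i)
    inS 0F = subst S (sym (⊕-identityʳ y)) Sy
    inS 1F = Sya
    inS 2F = Syab
    a<a+b : a < a + b
    a<a+b = m<m+n a 1≤b
    a+b<N : a + b < N
    a+b<N = +-bounded a≤n b≤n
    position<N : ∀ i → position i < N
    position<N 0F = s≤s z≤n
    position<N 1F = <-trans a<a+b a+b<N
    position<N 2F = a+b<N
    position-injective : ∀ i j → position i ≡ position j → i ≡ j
    position-injective 0F 0F _  = refl
    position-injective 0F 1F eq = ⊥-elim (<⇒≢ 1≤a eq)
    position-injective 0F 2F eq = ⊥-elim (<⇒≢ (<-trans 1≤a a<a+b) eq)
    position-injective 1F 0F eq = ⊥-elim (<⇒≢ 1≤a (sym eq))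
    position-injective 1F 1F _  = refl
    position-injective 1F 2F eq = ⊥-elim (<⇒≢ a<a+b eq)
    position-injective 2F 0F eq = ⊥-elim (<⇒≢ (<-trans 1≤a a<a+b) (sym eq))
    position-injective 2F 1F eq = ⊥-elim (<⇒≢ a<a+b (sym eq))
    position-injective 2F 2F _  = refl
    distinct : ∀ i j → vertex i ≡ vertex j → i ≡ j
    distinct i j eq = position-injective i j (⊕-injective y (position<N i) (position<N j) eq)
    arcs : ∀ (i : Fin 2) → D (vertex (inject₁ i)) (vertex (fsuc i))
    arcs 0F = subst (D (y ⊕ 0)) (⊕-assoc y 0 a) (arc (y ⊕ 0) 1≤a a≤n)
    arcs 1F = subst (D (y ⊕ a)) (⊕-assoc y a b) (arc (y ⊕ a) 1≤b b≤n)
    closing : D (y ⊕ (a + b)) (y ⊕ 0)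
    closing = subst (D (y ⊕ (a + b))) back-to-y (arc (y ⊕ (a + b)) (m<n⇒0<n∸m a+b<N) r≤n)
      where
      r : ℕ
      r = N ∸ (a + b)
      r≤n : r ≤ n
      r≤n = ≤-trans (∸-monoʳ-≤ N n<a+b) (≤-reflexive (trans (cong (_∸ suc n) N≡1+n+n) (m+n∸m≡n n n)))
      back-to-y : y ⊕ (a + b) ⊕ r ≡ y ⊕ 0
      back-to-y = begin
        y ⊕ (a + b) ⊕ r    ≡⟨ ⊕-assoc y (a + b) r ⟩
        y ⊕ (a + b + r)    ≡⟨ cong (y ⊕_) (m+[n∸m]≡n (<⇒≤ a+b<N)) ⟩
        y ⊕ N              ≡⟨ ⊕-M y ⟩
        y                  ≡⟨ ⊕-identityʳ y ⟨
        y ⊕ 0              ∎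
        where open ≡-Reasoning

  module _ {β : Vec (Fin 2) N} (valid : IsDicoloring 2 D β) (x : Fin N) (c : Fin 2) where

    ¬monochromatic-0-p-1+n : ∀ {p} → 1 ≤ p → p ≤ n →
      lookup β x ≡ c → lookup β (x ⊕ p) ≡ c → lookup β (x ⊕ suc n) ≡ c → ⊥
    ¬monochromatic-0-p-1+n {p} 1≤p p≤n β₀ βₚ β₁₊ₙ =
      valid c (triangle x 1≤p p≤n (m<n⇒0<n∸m (s≤s p≤n)) (∸-monoʳ-≤ (suc n) 1≤p)
                        (≤-reflexive (sym p+[1+n∸p]≡1+n))
                        β₀ βₚ (subst (λ w → lookup β w ≡ c) (cong (x ⊕_) (sym p+[1+n∸p]≡1+n)) β₁₊ₙ))
      where
      p+[1+n∸p]≡1+n : p + (suc n ∸ p) ≡ suc n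
      p+[1+n∸p]≡1+n = m+[n∸m]≡n (m≤n⇒m≤1+n p≤n)

    ¬monochromatic-1-1+t-1+n+t : ∀ {t} → 1 ≤ t → t ≤ n →
      lookup β (x ⊕ 1) ≡ c → lookup β (x ⊕ suc t) ≡ c → lookup β (x ⊕ (suc n + t)) ≡ c → ⊥
    ¬monochromatic-1-1+t-1+n+t {t} 1≤t t≤n β₁ β₁₊ₜ β₁₊ₙ₊ₜ =
      valid c (triangle (x ⊕ 1) 1≤t t≤n (≤-trans 1≤t t≤n) ≤-refl (m<n+m n 1≤t) β₁
                        (subst (λ w → lookup β w ≡ c) (sym (⊕-assoc x 1 t)) β₁₊ₜ)
                        (subst (λ w → lookup β w ≡ c) x⊕1+n+t≡x⊕1⊕[t+n] β₁₊ₙ₊ₜ))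
      where
      x⊕1+n+t≡x⊕1⊕[t+n] : x ⊕ (suc n + t) ≡ x ⊕ 1 ⊕ (t + n)
      x⊕1+n+t≡x⊕1⊕[t+n] = sym (trans (⊕-assoc x 1 (t + n)) (cong (λ m → x ⊕ suc m) (+-comm t n)))

  data Region : ℕ → Set where
    origin : Region 0
    inner  : ∀ {s} → s < n → Region (suc s)
    outer  : ∀ t → Region (suc n + t)

  region : ∀ s → Region s
  region zero = origin
  region (suc s) with s <? n
  ... | yes s<n = inner s<n
  ... | no  s≮n with m≤n⇒∃[o]m+o≡n (≮⇒≥ s≮n)
  ...   | t , refl = outer t

  n<1+n+t : ∀ t → n < suc n + t
  n<1+n+t t = s≤s (m≤m+n n t)

  outer<N⇒<n : ∀ {t} → suc n + t < N → t < n
  outer<N⇒<n {t} lt = +-cancelˡ-< (suc n) t n (subst (suc n + t <_) N≡1+n+n lt)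

  <n⇒outer<N : ∀ {t} → t < n → suc n + t < N
  <n⇒outer<N {t} t<n = subst (suc n + t <_) (sym N≡1+n+n) (s≤s (+-monoʳ-< n t<n))

  colourAt : Fin 2 → ℕ → Fin 2
  colourAt c zero = c
  colourAt c (suc s) with s <? n
  ... | yes _ = opposite c
  ... | no  _ = c

  colourAt-inner : ∀ c {s} → 1 ≤ s → s ≤ n → colourAt c s ≡ opposite c
  colourAt-inner c {suc s} _ s<n with s <? n
  ... | yes _   = refl
  ... | no  s≮n = ⊥-elim (s≮n s<n)

  colourAt-outer : ∀ c {s} → n < s → colourAt c s ≡ c
  colourAt-outer c {suc s} (s≤s n≤s) with s <? n
  ... | yes s<n = ⊥-elim (<⇒≱ s<n n≤s)
  ... | no  _   = refl

  blockColouring : Fin N × Fin 2 → Vec (Fin 2) N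
  blockColouring (x , c) = tabulate (λ w → colourAt c (offset x w))

  blockColouring-lookup : ∀ x c w → lookup (blockColouring (x , c)) w ≡ colourAt c (offset x w)
  blockColouring-lookup x c = lookup∘tabulate (λ w → colourAt c (offset x w))

  blockColouring-at : ∀ x c {s} → s < N → lookup (blockColouring (x , c)) (x ⊕ s) ≡ colourAt c s
  blockColouring-at x c {s} s<N =
    trans (blockColouring-lookup x c (x ⊕ s)) (cong (colourAt c) (offset-⊕< x s<N))

  blockColouring-self : ∀ x c → lookup (blockColouring (x , c)) x ≡ c
  blockColouring-self x c = trans (blockColouring-lookup x c x) (cong (colourAt c) (offset-self x))

  blockColouring-ext : ∀ {β : Vec (Fin 2) N} x c → (∀ s → s < N → lookup β (x ⊕ s) ≡ colourAt c s) →
                       β ≡ blockColouring (x , c)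
  blockColouring-ext x c agree = Pointwise-≡⇒≡ (ext (by-offset x λ s s<N →
    trans (agree s s<N) (sym (blockColouring-at x c s<N))))

  blockColouring-valid : ∀ u → IsDicoloring 2 D (blockColouring u)
  blockColouring-valid (x , c) i with i ≟ c
  ... | yes refl = acyclic-within y λ w colour≡c → subst (λ w → offset y w ≤ n) (⊕-offset x w)
                     (major (offset x w) (offset<M x w) (trans (sym (blockColouring-lookup x c w)) colour≡c))
    where
    y : Fin N
    y = x ⊕ suc n
    major : ∀ s → s < N → colourAt c s ≡ c → offset y (x ⊕ s) ≤ n
    major s s<N eq with region s
    ... | origin    = ≤-reflexive (trans (cong (offset y) (⊕0≡⊕1+n⊕n x)) (offset-⊕< y n<N))
    ... | inner s<n = ⊥-elim (opposite-≢ c (trans (sym (colourAt-inner c (s≤s z≤n) s<n)) eq))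
    ... | outer t   = ≤-trans (≤-reflexive (trans (cong (offset y) (sym (⊕-assoc x (suc n) t)))
                                                  (offset-⊕< y (<-trans t<n n<N))))
                              (<⇒≤ t<n)
      where
      t<n : t < n
      t<n = outer<N⇒<n s<N
  ... | no i≢c = acyclic-within x λ w colour≡i →
                   minor (offset x w) (trans (sym (blockColouring-lookup x c w)) colour≡i)
    where
    minor : ∀ s → colourAt c s ≡ i → s ≤ n
    minor s eq with region s
    ... | origin    = z≤n
    ... | inner s<n = s<n
    ... | outer t   = ⊥-elim (i≢c (trans (sym eq) (colourAt-outer c (n<1+n+t t))))

  ∃-sameColourAcross : (a : Fin N → Fin 2) → ∃[ x ] a x ≡ a (x ⊕ suc n)
  ∃-sameColourAcross a with any? (λ x → a x ≟ a (x ⊕ suc n))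
  ... | yes found = found
  ... | no  none  = ⊥-elim (none (fzero , sym (constant fzero (suc n))))
    where
    -- w and w ⊕ 1 = w ⊕ suc n ⊕ suc n both differ in colour from w ⊕ suc n.
    a-⊕1 : ∀ w → a (w ⊕ 1) ≡ a w
    a-⊕1 w = trans (≢⇒≡opposite {c = a (w ⊕ suc n)}
                      (λ eq → none (w ⊕ suc n , trans (sym eq) (cong a (sym (⊕1+n⊕1+n w))))))
                   (sym (≢⇒≡opposite (λ eq → none (w , eq))))
    constant : ∀ w k → a (w ⊕ k) ≡ a w
    constant w zero    = cong a (⊕-identityʳ w)
    constant w (suc k) = trans (cong a (⊕-suc w k)) (trans (a-⊕1 (w ⊕ k)) (constant w k))

  classification : ∀ {α} → IsDicoloring 2 D α → ∃[ u ] α ≡ blockColouring u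
  classification {α} valid = (x , c) , blockColouring-ext x c agree
    where
    a : Fin N → Fin 2
    a = lookup α
    x : Fin N
    x = proj₁ (∃-sameColourAcross a)
    c : Fin 2
    c = a x
    across : a (x ⊕ suc n) ≡ c
    across = sym (proj₂ (∃-sameColourAcross a))
    inner-opposite : ∀ {p} → 1 ≤ p → p ≤ n → a (x ⊕ p) ≡ opposite c
    inner-opposite 1≤p p≤n =
      ≢⇒≡opposite (λ eq → ¬monochromatic-0-p-1+n {β = α} valid x c 1≤p p≤n refl eq across)
    agree : ∀ s → s < N → a (x ⊕ s) ≡ colourAt c s
    agree s s<N with region s
    ... | origin        = cong a (⊕-identityʳ x)
    ... | inner s<n     = trans (inner-opposite (s≤s z≤n) s<n) (sym (colourAt-inner c (s≤s z≤n) s<n))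
    ... | outer zero    = trans (cong (a ∘ (x ⊕_)) (+-identityʳ (suc n)))
                                (trans across (sym (colourAt-outer c (n<1+n+t 0))))
    ... | outer (suc t) = trans (≢opposite⇒≡ λ eq →
                                   ¬monochromatic-1-1+t-1+n+t {β = α} valid x (opposite c) (s≤s z≤n) (<⇒≤ t<n)
                                     (inner-opposite ≤-refl (≤-trans (s≤s z≤n) t<n))
                                     (inner-opposite (s≤s z≤n) t<n) eq)
                                (sym (colourAt-outer c (n<1+n+t (suc t))))
      where
      t<n : suc t < n
      t<n = outer<N⇒<n s<N

  blockColouring-major : ∀ x c {t} → t ≤ n → lookup (blockColouring (x , c)) (x ⊕ suc n ⊕ t) ≡ c
  blockColouring-major x c {t} t≤n with m≤n⇒m<n∨m≡n t≤n
  ... | inj₁ t<n  = trans (cong (lookup (blockColouring (x , c))) (⊕-assoc x (suc n) t))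
                          (trans (blockColouring-at x c (<n⇒outer<N t<n)) (colourAt-outer c (n<1+n+t t)))
  ... | inj₂ refl = trans (cong (lookup (blockColouring (x , c))) (trans (sym (⊕0≡⊕1+n⊕n x)) (⊕-identityʳ x)))
                          (blockColouring-self x c)

  blockColouring-across-unique : ∀ x c w → let H = blockColouring (x , c) in
                                 lookup H w ≡ lookup H (w ⊕ suc n) → w ≡ x
  blockColouring-across-unique x c =
    by-offset x λ s s<N same → trans (cong (x ⊕_) (offset≡0 s s<N same)) (⊕-identityʳ x)
    where
    H : Vec (Fin 2) N
    H = blockColouring (x , c)
    offset≡0 : ∀ s → s < N → lookup H (x ⊕ s) ≡ lookup H (x ⊕ s ⊕ suc n) → s ≡ 0
    offset≡0 s s<N same with region s
    ... | origin    = refl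
    ... | inner s<n = ⊥-elim (opposite-≢ c (begin
      opposite c                 ≡⟨ colourAt-inner c (s≤s z≤n) s<n ⟨
      colourAt c s               ≡⟨ blockColouring-at x c s<N ⟨
      lookup H (x ⊕ s)           ≡⟨ same ⟩
      lookup H (x ⊕ s ⊕ suc n)   ≡⟨ cong (lookup H) (⊕-swap x s (suc n)) ⟩
      lookup H (x ⊕ suc n ⊕ s)   ≡⟨ blockColouring-major x c s<n ⟩
      c                          ∎))
      where open ≡-Reasoning
    ... | outer t   = ⊥-elim (opposite-≢ c (begin
      opposite c                 ≡⟨ colourAt-inner c (s≤s z≤n) t<n ⟨
      colourAt c (suc t)         ≡⟨ blockColouring-at x c (≤-<-trans t<n n<N) ⟨
      lookup H (x ⊕ suc t)       ≡⟨ cong (lookup H) wrap ⟨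
      lookup H (x ⊕ s ⊕ suc n)   ≡⟨ same ⟨
      lookup H (x ⊕ s)           ≡⟨ blockColouring-at x c s<N ⟩
      colourAt c s               ≡⟨ colourAt-outer c (n<1+n+t t) ⟩
      c                          ∎))
      where
      open ≡-Reasoning
      t<n : t < n
      t<n = outer<N⇒<n s<N
      wrap : x ⊕ (suc n + t) ⊕ suc n ≡ x ⊕ suc t
      wrap = trans (⊕-assoc x (suc n + t) (suc n))
                   (trans (cong (x ⊕_) (1+n+t+1+n≡N+1+t n t)) (⊕-period x (suc t)))

  blockColouring-injective : ∀ {u u′} → blockColouring u ≡ blockColouring u′ → u ≡ u′
  blockColouring-injective {x , c} {x′ , c′} eq = cong₂ _,_ (sym x′≡x) c≡c′
    where
    H′ : Vec (Fin 2) N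
    H′ = blockColouring (x′ , c′)
    across′ : lookup H′ x′ ≡ lookup H′ (x′ ⊕ suc n)
    across′ = trans (blockColouring-self x′ c′)
                    (sym (trans (cong (lookup H′) (sym (⊕-identityʳ (x′ ⊕ suc n))))
                                (blockColouring-major x′ c′ z≤n)))
    x′≡x : x′ ≡ x
    x′≡x = blockColouring-across-unique x c x′
             (subst (λ β → lookup β x′ ≡ lookup β (x′ ⊕ suc n)) (sym eq) across′)
    c≡c′ : c ≡ c′
    c≡c′ = begin
      c                                  ≡⟨ blockColouring-self x c ⟨
      lookup (blockColouring (x , c)) x  ≡⟨ cong₂ lookup eq (sym x′≡x) ⟩
      lookup H′ x′                       ≡⟨ blockColouring-self x′ c′ ⟩
      c′                                 ∎
      where open ≡-Reasoning

  next : Fin N × Fin 2 → Fin N × Fin 2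
  next (x , c) = x ⊕ suc n , opposite c

  prev : Fin N × Fin 2 → Fin N × Fin 2
  prev (x , c) = x ⊕ n , opposite c

  next-prev : ∀ u → next (prev u) ≡ u
  next-prev (x , c) = cong₂ _,_ (⊕n⊕1+n x) (opposite-involutive c)

  module _ (1≤n : 1 ≤ n) where

    1+n<N : suc n < N
    1+n<N = +-bounded 1≤n ≤-refl

    blockColouring-next : ∀ x c →
      DiffersExactlyAt (x ⊕ suc n) (blockColouring (x , c)) (blockColouring (next (x , c)))
    blockColouring-next x c = differ , by-offset x agree
      where
      y : Fin N
      y = x ⊕ suc n
      c̄ : Fin 2
      c̄ = opposite c
      H H′ : Vec (Fin 2) N
      H  = blockColouring (x , c)
      H′ = blockColouring (y , c̄)
      differ : lookup H y ≢ lookup H′ y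
      differ eq = opposite-≢ c (begin
        c̄                   ≡⟨ blockColouring-self y c̄ ⟨
        lookup H′ y         ≡⟨ eq ⟨
        lookup H y          ≡⟨ blockColouring-at x c 1+n<N ⟩
        colourAt c (suc n)  ≡⟨ colourAt-outer c ≤-refl ⟩
        c                   ∎)
        where open ≡-Reasoning
      via : ∀ {s t} → s < N → t < N → x ⊕ s ≡ y ⊕ t → colourAt c s ≡ colourAt c̄ t →
            lookup H (x ⊕ s) ≡ lookup H′ (x ⊕ s)
      via {s} {t} s<N t<N x⊕s≡y⊕t colours = begin
        lookup H (x ⊕ s)    ≡⟨ blockColouring-at x c s<N ⟩
        colourAt c s        ≡⟨ colours ⟩
        colourAt c̄ t        ≡⟨ blockColouring-at y c̄ t<N ⟨
        lookup H′ (y ⊕ t)   ≡⟨ cong (lookup H′) x⊕s≡y⊕t ⟨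
        lookup H′ (x ⊕ s)   ∎
        where open ≡-Reasoning
      agree : ∀ s → s < N → x ⊕ s ≢ y → lookup H (x ⊕ s) ≡ lookup H′ (x ⊕ s)
      agree s s<N x⊕s≢y with region s
      ... | origin        = via s<N n<N (⊕0≡⊕1+n⊕n x)
                              (sym (trans (colourAt-inner c̄ 1≤n ≤-refl) (opposite-involutive c)))
      ... | inner s<n     = via s<N (+-bounded ≤-refl s<n) wrap
                              (trans (colourAt-inner c (s≤s z≤n) s<n)
                                     (sym (colourAt-outer c̄ (m<m+n n (s≤s z≤n)))))
        where
        wrap : x ⊕ s ≡ y ⊕ (n + s)
        wrap = sym (trans (⊕-assoc x (suc n) (n + s)) (trans (cong (x ⊕_) (1+n+[n+s]≡N+s n s)) (⊕-period x s)))
      ... | outer zero    = ⊥-elim (x⊕s≢y (cong (x ⊕_) (+-identityʳ (suc n))))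
      ... | outer (suc t) = via s<N (<-trans t<n n<N) (sym (⊕-assoc x (suc n) (suc t)))
                              (trans (colourAt-outer c (n<1+n+t (suc t)))
                                     (sym (trans (colourAt-inner c̄ (s≤s z≤n) (<⇒≤ t<n)) (opposite-involutive c))))
        where
        t<n : suc t < n
        t<n = outer<N⇒<n s<N

    blockColouring-prev : ∀ x c →
      DiffersExactlyAt x (blockColouring (x , c)) (blockColouring (prev (x , c)))
    blockColouring-prev x c =
      subst₂ (λ v γ → DiffersExactlyAt v γ (blockColouring (prev (x , c))))
             (cong proj₁ (next-prev (x , c))) (cong blockColouring (next-prev (x , c)))
             (DiffersExactlyAt-sym {α = blockColouring (prev (x , c))} {β = blockColouring (next (prev (x , c)))}
                                   (blockColouring-next (x ⊕ n) (opposite c)))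

    blockColouring-neighbour : ∀ {β} → IsDicoloring 2 D β → ∀ u {v} →
                               DiffersExactlyAt v (blockColouring u) β →
                               β ≡ blockColouring (next u) ⊎ β ≡ blockColouring (prev u)
    blockColouring-neighbour {β} valid (x , c) {v} differs =
      at (offset x v) (offset<M x v) (subst (λ v → DiffersExactlyAt v H β) (sym (⊕-offset x v)) differs)
      where
      H : Vec (Fin 2) N
      H = blockColouring (x , c)
      unchanged : ∀ {s} → DiffersExactlyAt (x ⊕ s) H β → s < N →
                  ∀ {r} → r < N → r ≢ s → lookup β (x ⊕ r) ≡ colourAt c r
      unchanged (_ , H≡β) s<N r<N r≢s =
        trans (sym (H≡β _ (r≢s ∘ ⊕-injective x r<N s<N))) (blockColouring-at x c r<N)
      recoloured : ∀ {s} → DiffersExactlyAt (x ⊕ s) H β → s < N → lookup β (x ⊕ s) ≡ opposite (colourAt c s)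
      recoloured (H≢β , _) s<N = ≢⇒≡opposite (λ eq → H≢β (trans (blockColouring-at x c s<N) (sym eq)))
      at : ∀ s → s < N → DiffersExactlyAt (x ⊕ s) H β →
           β ≡ blockColouring (next (x , c)) ⊎ β ≡ blockColouring (prev (x , c))
      at s s<N d with region s
      ... | origin        = inj₂ (DiffersExactlyAt-unique {α = H} d
        (subst (λ v → DiffersExactlyAt v H (blockColouring (prev (x , c)))) (sym (⊕-identityʳ x))
               (blockColouring-prev x c)))
      ... | inner s<n     = ⊥-elim (¬monochromatic-0-p-1+n {β = β} valid x c (s≤s z≤n) s<n
        (trans (cong (lookup β) (sym (⊕-identityʳ x))) (unchanged d s<N (s≤s z≤n) (λ ())))
        (trans (recoloured d s<N) (trans (cong opposite (colourAt-inner c (s≤s z≤n) s<n)) (opposite-involutive c)))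
        (trans (unchanged d s<N 1+n<N (<⇒≢ s<n ∘ sym ∘ suc-injective)) (colourAt-outer c ≤-refl)))
      ... | outer zero    = inj₁ (DiffersExactlyAt-unique {α = H} d
        (subst (λ v → DiffersExactlyAt v H (blockColouring (next (x , c)))) (cong (x ⊕_) (sym (+-identityʳ (suc n))))
               (blockColouring-next x c)))
      ... | outer (suc t) = ⊥-elim (¬monochromatic-1-1+t-1+n+t {β = β} valid x (opposite c) (s≤s z≤n) (<⇒≤ t<n)
        (trans (unchanged d s<N (+-bounded 1≤n z≤n) (<⇒≢ 1<s)) (colourAt-inner c ≤-refl 1≤n))
        (trans (unchanged d s<N (≤-<-trans t<n n<N) (<⇒≢ 2+t<s)) (colourAt-inner c (s≤s z≤n) t<n))
        (trans (recoloured d s<N) (cong opposite (colourAt-outer c (n<1+n+t (suc t))))))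
        where
        t<n : suc t < n
        t<n = outer<N⇒<n s<N
        1<s : 1 < suc n + suc t
        1<s = s≤s (≤-trans 1≤n (m≤m+n n (suc t)))
        2+t<s : suc (suc t) < suc n + suc t
        2+t<s = s≤s (+-monoˡ-< (suc t) 1≤n)

    blockColouring-adjacent⇔ : ∀ u u′ → DifferOnExactlyOne (blockColouring u) (blockColouring u′) ⇔
                                        (u′ ≡ next u ⊎ u ≡ next u′)
    blockColouring-adjacent⇔ u u′ = mk⇔ adjacent⇒ adjacent⇐
      where
      adjacent⇒ : DifferOnExactlyOne (blockColouring u) (blockColouring u′) → u′ ≡ next u ⊎ u ≡ next u′
      adjacent⇒ (_ , d) with blockColouring-neighbour (blockColouring-valid u′) u d
      ... | inj₁ eq = inj₁ (blockColouring-injective {u′} {next u} eq)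
      ... | inj₂ eq = inj₂ (begin
        u               ≡⟨ next-prev u ⟨
        next (prev u)   ≡⟨ cong next (blockColouring-injective {u′} {prev u} eq) ⟨
        next u′         ∎)
        where open ≡-Reasoning
      adjacent⇐ : u′ ≡ next u ⊎ u ≡ next u′ → DifferOnExactlyOne (blockColouring u) (blockColouring u′)
      adjacent⇐ (inj₁ refl) = _ , blockColouring-next (proj₁ u) (proj₂ u)
      adjacent⇐ (inj₂ refl) = _ , DiffersExactlyAt-sym {α = blockColouring u′} {β = blockColouring (next u′)}
                                                       (blockColouring-next (proj₁ u′) (proj₂ u′))

  orbit : ℕ → Fin N × Fin 2
  orbit = fold (fzero , 0F) next

  next² : ∀ x c → next (next (x , c)) ≡ (x ⊕ 1 , c)
  next² x c = cong₂ _,_ (⊕1+n⊕1+n x) (opposite-involutive c)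

  orbit-even : ∀ q → orbit (q + q) ≡ (fzero ⊕ q , 0F)
  orbit-even zero    = cong (_, 0F) (sym (⊕-identityʳ fzero))
  orbit-even (suc q) = begin
    orbit (suc q + suc q)          ≡⟨ cong (orbit ∘ suc) (+-suc q q) ⟩
    next (next (orbit (q + q)))    ≡⟨ cong (next ∘ next) (orbit-even q) ⟩
    next (next (fzero ⊕ q , 0F))   ≡⟨ next² (fzero ⊕ q) 0F ⟩
    (fzero ⊕ q ⊕ 1 , 0F)           ≡⟨ cong (_, 0F) (⊕-suc fzero q) ⟨
    (fzero ⊕ suc q , 0F)           ∎
    where open ≡-Reasoning

  orbit-odd : ∀ q → orbit (suc (q + q)) ≡ (fzero ⊕ q ⊕ suc n , 1F)
  orbit-odd q = cong next (orbit-even q)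

  orbit-period : orbit (N + N) ≡ orbit 0
  orbit-period = trans (orbit-even N) (cong (_, 0F) (⊕-M fzero))

  halve : ∀ i → ∃[ q ] (i ≡ q + q ⊎ i ≡ suc (q + q))
  halve zero = 0 , inj₁ refl
  halve (suc i) with halve i
  ... | q , inj₁ refl = q , inj₂ refl
  ... | q , inj₂ refl = suc q , inj₁ (cong suc (sym (+-suc q q)))

  half<N : ∀ {q} → q + q < N + N → q < N
  half<N {q} q+q<N+N = ≰⇒> λ N≤q → <⇒≱ q+q<N+N (+-mono-≤ N≤q N≤q)

  orbit-injective : ∀ {i j} → i < N + N → j < N + N → orbit i ≡ orbit j → i ≡ j
  orbit-injective {i} {j} i<N+N j<N+N eq with halve i | halve j
  ... | q , inj₁ refl | q′ , inj₁ refl = cong (λ m → m + m)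
    (⊕-injective fzero {q} {q′} (half<N i<N+N) (half<N j<N+N)
      (cong proj₁ (trans (sym (orbit-even q)) (trans eq (orbit-even q′)))))
  ... | q , inj₂ refl | q′ , inj₂ refl = cong (λ m → suc (m + m))
    (⊕-injective fzero {q} {q′} (half<N (<⇒≤ i<N+N)) (half<N (<⇒≤ j<N+N))
      (⊕1+n-injective (cong proj₁ (trans (sym (orbit-odd q)) (trans eq (orbit-odd q′))))))
  ... | q , inj₁ refl | q′ , inj₂ refl
    with () ← cong proj₂ (trans (sym (orbit-even q)) (trans eq (orbit-odd q′)))
  ... | q , inj₂ refl | q′ , inj₁ refl
    with () ← cong proj₂ (trans (sym (orbit-odd q)) (trans eq (orbit-even q′)))

  fzero⊕toℕ : ∀ x → fzero ⊕ toℕ x ≡ x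
  fzero⊕toℕ x = toℕ-injective (trans (toℕ-⊕ fzero (toℕ x)) (m<n⇒m%n≡m (toℕ<n x)))

  orbit-surjective : ∀ u → ∃[ i ] i < N + N × orbit i ≡ u
  orbit-surjective (x , 0F) =
    toℕ x + toℕ x , +-mono-< (toℕ<n x) (toℕ<n x) , trans (orbit-even (toℕ x)) (cong (_, 0F) (fzero⊕toℕ x))
  orbit-surjective (x , 1F) =
    suc (toℕ (x ⊕ n) + toℕ (x ⊕ n)) , +-mono-≤-< (toℕ<n (x ⊕ n)) (toℕ<n (x ⊕ n)) ,
    trans (orbit-odd (toℕ (x ⊕ n))) (cong (_, 1F) (trans (cong (_⊕ suc n) (fzero⊕toℕ (x ⊕ n))) (⊕n⊕1+n x)))

  dicolouringGraph≅cycle : 1 ≤ n → CycleIsoDicolGraph (suc (4 * n + 1)) 2 D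
  dicolouringGraph≅cycle 1≤n = record
    { f          = λ i → blockColouring (orbit (toℕ i)) , blockColouring-valid (orbit (toℕ i))
    ; injective  = λ i j eq → toℕ-injective (orbit-injective′ (toℕ<n i) (toℕ<n j) (blockColouring-injective eq))
    ; surjective = surjective
    ; adj⇔       = λ i j → from (blockColouring-adjacent⇔ 1≤n _ _) ∘ to (orbitAdj⇔ i j)
                         , from (orbitAdj⇔ i j) ∘ to (blockColouring-adjacent⇔ 1≤n _ _)
    }
    where
    K : ℕ
    K = suc (4 * n + 1)
    orbit-injective′ : ∀ {i j} → i < K → j < K → orbit i ≡ orbit j → i ≡ j
    orbit-injective′ {i} {j} i<K j<K = orbit-injective (subst (i <_) (K≡N+N n) i<K) (subst (j <_) (K≡N+N n) j<K)
    orbitAdj⇔ : ∀ i j → CycleAdj K i j ⇔ (orbit (toℕ j) ≡ next (orbit (toℕ i))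
                                          ⊎ orbit (toℕ i) ≡ next (orbit (toℕ j)))
    orbitAdj⇔ = Cyclic.cycleAdj⇔orbitAdj K next (fzero , 0F) (trans (cong orbit (K≡N+N n)) orbit-period)
                                         orbit-injective′
    surjective : ∀ (α : Dicoloring 2 D) → Σ (Fin K) λ i → blockColouring (orbit (toℕ i)) ≡ proj₁ α
    surjective (α , valid) with classification valid
    ... | u , α≡u with orbit-surjective u
    ...   | i , i<N+N , orbit≡u = fromℕ< i<K , (begin
      blockColouring (orbit (toℕ (fromℕ< i<K)))  ≡⟨ cong (blockColouring ∘ orbit) (toℕ-fromℕ< i<K) ⟩
      blockColouring (orbit i)                   ≡⟨ cong blockColouring orbit≡u ⟩
      blockColouring u                           ≡⟨ α≡u ⟨
      α                                          ∎)
      where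
      open ≡-Reasoning
      i<K : i < K
      i<K = subst (i <_) (sym (K≡N+N n)) i<N+N

-- The argument only needs n ≥ 1.
proposition2 : (n : ℕ) → 2 ≤ n →
    CycleIsoDicolGraph (suc (4 * n + 1)) 2 (CyclicTournament n)
    × Diameter (DicolAdj {k = 2} {D = CyclicTournament n}) (2 * n + 1)
proposition2 n 2≤n = iso , CycleIso⇒Diameter iso cycle-diameter
  where
  cycle-diameter : Diameter (CycleAdj (suc (4 * n + 1))) (2 * n + 1)
  cycle-diameter = Cyclic.cycle-diameter (suc (4 * n + 1)) (m≤n+m 1 (2 * n)) (K≡T+T n)
  iso : CycleIsoDicolGraph (suc (4 * n + 1)) 2 (CyclicTournament n)
  iso = Tournament.dicolouringGraph≅cycle n (≤-trans (s≤s z≤n) 2≤n)
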